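{- Let $k\geq 2$, $n\geq 0$, and let $\sigma=\sigma(1)\cdots\sigma((k-1)n)$ be the short $k$-Catalan--Spitzer permutation induced by a $k$-Catalan path $P$ of order $n$. Then for each $i$, the level of the up step of $P$ labeled $\sigma(i)$ equals the level of the vertex $\sigma(i)$ in the Foata--Strehl tree $\mathcal{FS}(\sigma)$.
   Context: A $k$-Catalan path of order $n$ is a lattice path from $(0,0)$ to $(kn,0)$ consisting of $(k-1)n$ up steps $(1,1)$ and $n$ down steps $(1,1-k)$ never going below the $x$-axis; the level of an up step is the $y$-coordinate of its starting point. The short $k$-Catalan--Spitzer permutation induced by $P$ is obtained by labeling the up steps of $P$ bijectively with $1,\ldots,(k-1)n$ so that labels increase from right to left among up steps at the same level and every up step at a lower level gets a smaller label than every up step at a higher level, and recording the labels in the order the up steps occur along $P$. The Foata--Strehl tree $\mathcal{FS}(w_1\cdots w_m)$ of a word with distinct letters is defined recursively: its root is labeled $w_i=\min(w_1,\ldots,w_m)$, its left subtree is $\mathcal{FS}(w_1\cdots w_{i-1})$ (absent if $i=1$) and its right subtree is $\mathcal{FS}(w_{i+1}\cdots w_m)$ (absent if $i=m$). The level of a vertex in this tree is the number of steps from a parent to its right child on the path from the root to that vertex. -}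

module Defs where

open import Data.Nat using (ℕ; zero; suc; _∸_; _≤_; _⊓_; _≡ᵇ_)
open import Data.List using (List; []; _∷_; length; foldr)
open import Data.Maybe using (Maybe; just; nothing; map)
open import Data.Product using (_×_; _,_)
open import Data.Bool using (if_then_else_)
open import Relation.Binary.PropositionalEquality using (_≡_)

-- Steps of a k-Catalan path: U = (1,1), D = (1,1-k).
data Step : Set where
  U D : Step

countU countD : List Step → ℕ
countU [] = 0
countU (U ∷ s) = suc (countU s)
countU (D ∷ s) = countU s
countD [] = 0
countD (U ∷ s) = countD s
countD (D ∷ s) = suc (countD s)

NonNeg : ℕ → ℕ → List Step → Set
NonNeg k h [] = h ≡ 0
NonNeg k h (U ∷ s) = NonNeg k (suc h) s
NonNeg k h (D ∷ s) = (k ∸ 1 ≤ h) × NonNeg k (h ∸ (k ∸ 1)) s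

IsCatalanPath : ℕ → ℕ → List Step → Set
IsCatalanPath k n P = (countU P ≡ (k ∸ 1) Data.Nat.* n) × (countD P ≡ n) × NonNeg k 0 P

-- Levels (starting y-coordinates) of the up steps, in order along the path,
-- starting at height h.
upLevels : ℕ → ℕ → List Step → List ℕ
upLevels k h [] = []
upLevels k h (U ∷ s) = h ∷ upLevels k (suc h) s
upLevels k h (D ∷ s) = upLevels k (h ∸ (k ∸ 1)) s

-- i-th entry (0-based) of a list; default 0 out of range (only used in range).
at : List ℕ → ℕ → ℕ
at [] _ = 0
at (x ∷ xs) zero = x
at (x ∷ xs) (suc i) = at xs i

data Tree : Set where
  leaf : Tree
  node : Tree → ℕ → Tree → Tree

splitAt1 : ℕ → List ℕ → List ℕ × List ℕ
splitAt1 m [] = [] , []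
splitAt1 m (y ∷ ys) with splitAt1 m ys
... | (a , b) = if y ≡ᵇ m then ([] , ys) else ((y ∷ a) , b)

-- Foata–Strehl tree, with fuel (fuel = length of the word suffices,
-- since each recursive call is on a strictly shorter word).
fsF : ℕ → List ℕ → Tree
fsF _ [] = leaf
fsF zero (_ ∷ _) = leaf
fsF (suc f) (x ∷ xs) with foldr _⊓_ x xs
... | m with splitAt1 m (x ∷ xs)
... | (l , r) = node (fsF f l) m (fsF f r)

FS : List ℕ → Tree
FS w = fsF (length w) w

-- level of the vertex labelled a: number of parent→right-child steps
-- on the path from the root to that vertex (nothing if absent).
levelIn : Tree → ℕ → Maybe ℕ
levelIn leaf a = nothing
levelIn (node l x r) a with x ≡ᵇ a
... | Data.Bool.true = just 0
... | Data.Bool.false with levelIn l a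
...   | just v = just v
...   | nothing = map suc (levelIn r a)

-- Read the up-step levels along the path as a sequence that starts at its minimum c and rises by
-- at most one per step; labels increase with the level and, within a level, from right to left.
-- The smallest label, the root of the Foata–Strehl tree, then sits at the last position p of
-- level c: if p were higher, the first position (at level c) would carry a smaller label, and
-- so would any later position at level c.  The positions before p form a sequence of the same kind
-- with base c, and those after p one with base c + 1, because right after p the level can only
-- rise to c + 1 and never returns to c.  So each right edge of the tree raises the base by one,
-- and induction on the word shows that tree level = path level − c.
module Submission where

open import Defs
open import Data.Nat using (ℕ; zero; suc; _+_; _∸_; _*_; _⊓_; _≡ᵇ_; _≤_; _<_; z≤n; s≤s; z<s)
open import Data.Nat.Properties
open import Data.List using (List; []; _∷_; length; take; drop; foldr; map; upTo)
open import Data.List.Properties using (length-map; length-upTo; length-take; length-drop; foldr-preservesᵇ)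
open import Data.List.Relation.Unary.All using (All; []; _∷_)
open import Data.List.Relation.Binary.Permutation.Propositional using (_↭_)
open import Data.List.Relation.Binary.Permutation.Propositional.Properties using (↭-length)
open import Data.Maybe using (just; nothing) renaming (map to mapMaybe)
open import Data.Bool using (true; false; if_then_else_)
open import Data.Product using (Σ-syntax; _×_; _,_; proj₁; proj₂)
open import Data.Sum using (inj₁; inj₂)
open import Data.Empty using (⊥-elim)
open import Relation.Binary using (Tri; tri<; tri≈; tri>)
open import Relation.Binary.PropositionalEquality
  using (_≡_; _≢_; refl; sym; trans; cong; subst; subst₂; ≢-sym)

m∸n≡1+[m∸1+n] : ∀ {m n} → n < m → m ∸ n ≡ suc (m ∸ suc n)
m∸n≡1+[m∸1+n] {suc m} {zero}  _         = refl
m∸n≡1+[m∸1+n] {suc m} {suc n} (s≤s n<m) = m∸n≡1+[m∸1+n] n<m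

at-take : ∀ (xs : List ℕ) {p j} → j < p → at (take p xs) j ≡ at xs j
at-take (x ∷ xs) {suc p} {zero}  _         = refl
at-take (x ∷ xs) {suc p} {suc j} (s≤s j<p) = at-take xs j<p
at-take []       {suc p}         _         = refl

at-drop : ∀ (xs : List ℕ) p j → at (drop p xs) j ≡ at xs (p + j)
at-drop xs       zero    j = refl
at-drop []       (suc p) j = refl
at-drop (x ∷ xs) (suc p) j = at-drop xs p j

All-at : ∀ {P : ℕ → Set} (xs : List ℕ) → (∀ q → q < length xs → P (at xs q)) → All P xs
All-at []       h = []
All-at (x ∷ xs) h = h zero (s≤s z≤n) ∷ All-at xs (λ q q< → h (suc q) (s≤s q<))

foldr-⊓-All : ∀ {P : ℕ → Set} x xs → All P (x ∷ xs) → P (foldr _⊓_ x xs)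
foldr-⊓-All {P} x xs (px ∷ pxs) = foldr-preservesᵇ ⊓-preserves px pxs
  where
  ⊓-preserves : ∀ {a b} → P a → P b → P (a ⊓ b)
  ⊓-preserves {a} {b} pa pb with ⊓-sel a b
  ... | inj₁ eq = subst P (sym eq) pa
  ... | inj₂ eq = subst P (sym eq) pb

foldr-⊓≤at : ∀ x xs {j} → j < length (x ∷ xs) → foldr _⊓_ x xs ≤ at (x ∷ xs) j
foldr-⊓≤at x []       {zero}        _         = ≤-refl
foldr-⊓≤at x []       {suc j}       (s≤s ())
foldr-⊓≤at x (y ∷ ys) {zero}        _         = ≤-trans (m⊓n≤n y _) (foldr-⊓≤at x ys (s≤s z≤n))
foldr-⊓≤at x (y ∷ ys) {suc zero}    _         = m⊓n≤m y _
foldr-⊓≤at x (y ∷ ys) {suc (suc j)} (s≤s j<n) = ≤-trans (m⊓n≤n y _) (foldr-⊓≤at x ys j<n)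

foldr-⊓-position : ∀ x xs → Σ[ p ∈ ℕ ] p < length (x ∷ xs) × at (x ∷ xs) p ≡ foldr _⊓_ x xs
foldr-⊓-position x []       = zero , s≤s z≤n , refl
foldr-⊓-position x (y ∷ ys) with ⊓-sel y (foldr _⊓_ x ys) | foldr-⊓-position x ys
... | inj₁ eq | _                     = 1 , s≤s (s≤s z≤n) , sym eq
... | inj₂ eq | zero  , _       , at≡ = zero , s≤s z≤n , trans at≡ (sym eq)
... | inj₂ eq | suc q , s≤s q<n , at≡ = suc (suc q) , s≤s (s≤s q<n) , trans at≡ (sym eq)

≡ᵇ-refl : ∀ m → (m ≡ᵇ m) ≡ true
≡ᵇ-refl zero    = refl
≡ᵇ-refl (suc m) = ≡ᵇ-refl m

≢⇒≡ᵇ-false : ∀ {a b} → a ≢ b → (a ≡ᵇ b) ≡ false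
≢⇒≡ᵇ-false {zero}  {zero}  a≢b = ⊥-elim (a≢b refl)
≢⇒≡ᵇ-false {zero}  {suc b} _   = refl
≢⇒≡ᵇ-false {suc a} {zero}  _   = refl
≢⇒≡ᵇ-false {suc a} {suc b} a≢b = ≢⇒≡ᵇ-false (λ a≡b → a≢b (cong suc a≡b))

splitAt1-∷ : ∀ m y ys → splitAt1 m (y ∷ ys) ≡
  (if y ≡ᵇ m then ([] , ys) else (y ∷ proj₁ (splitAt1 m ys) , proj₂ (splitAt1 m ys)))
splitAt1-∷ m y ys with splitAt1 m ys
... | _ , _ = refl

splitAt1-All : ∀ {P : ℕ → Set} m ws → All P ws →
  All P (proj₁ (splitAt1 m ws)) × All P (proj₂ (splitAt1 m ws))
splitAt1-All m []       []         = [] , []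
splitAt1-All m (y ∷ ys) (py ∷ pys) rewrite splitAt1-∷ m y ys with y ≡ᵇ m
... | true  = [] , pys
... | false = py ∷ proj₁ (splitAt1-All m ys pys) , proj₂ (splitAt1-All m ys pys)

splitAt1-first : ∀ m ws {p} → p < length ws → at ws p ≡ m → (∀ q → q < p → at ws q ≢ m) →
  splitAt1 m ws ≡ (take p ws , drop (suc p) ws)
splitAt1-first m (y ∷ ys) {zero} _ y≡m _
  rewrite splitAt1-∷ m y ys | y≡m | ≡ᵇ-refl m = refl
splitAt1-first m (y ∷ ys) {suc p} (s≤s p<n) at≡m earlier≢m
  rewrite splitAt1-∷ m y ys | ≢⇒≡ᵇ-false (earlier≢m zero (s≤s z≤n))
        | splitAt1-first m ys p<n at≡m (λ q q<p → earlier≢m (suc q) (s≤s q<p)) = refl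

levelIn-root : ∀ l x r {a} → (x ≡ᵇ a) ≡ true → levelIn (node l x r) a ≡ just 0
levelIn-root l x r {a} x≡a with x ≡ᵇ a
levelIn-root l x r () | false
... | true = refl

levelIn-left : ∀ l x r {a v} → (x ≡ᵇ a) ≡ false → levelIn l a ≡ just v →
  levelIn (node l x r) a ≡ just v
levelIn-left l x r {a} x≢a inl with x ≡ᵇ a
levelIn-left l x r () inl | true
... | false with levelIn l a
levelIn-left l x r x≢a () | false | nothing
... | just _ = inl

levelIn-right : ∀ l x r {a} → (x ≡ᵇ a) ≡ false → levelIn l a ≡ nothing →
  levelIn (node l x r) a ≡ mapMaybe suc (levelIn r a)
levelIn-right l x r {a} x≢a notInl with x ≡ᵇ a
levelIn-right l x r () notInl | true
... | false with levelIn l a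
levelIn-right l x r x≢a () | false | just _
... | nothing = refl

levelIn-fsF-absent : ∀ f ws {a} → All (_≢ a) ws → levelIn (fsF f ws) a ≡ nothing
levelIn-fsF-absent f       []       _  = refl
levelIn-fsF-absent zero    (x ∷ xs) _  = refl
levelIn-fsF-absent (suc f) (x ∷ xs) {a} ≢a =
  trans (levelIn-right _ m _ (≢⇒≡ᵇ-false (foldr-⊓-All x xs ≢a))
                       (levelIn-fsF-absent f _ (proj₁ parts)))
        (cong (mapMaybe suc) (levelIn-fsF-absent f _ (proj₂ parts)))
  where
  m = foldr _⊓_ x xs
  parts = splitAt1-All m (x ∷ xs) ≢a

record SpitzerLabelling (n : ℕ) (gs ws : List ℕ) : Set where
  field
    lower-first : ∀ a b → a < n → b < n → at gs a < at gs b → at ws a < at ws b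
    rightmost-first : ∀ a b → a < n → b < n → at gs a ≡ at gs b → a < b → at ws b < at ws a

  injective : ∀ {a b} → a < n → b < n → at ws a ≡ at ws b → a ≡ b
  injective {a} {b} a<n b<n eq with <-cmp (at gs a) (at gs b) | <-cmp a b
  ... | tri< lt _ _ | _           = ⊥-elim (<-irrefl eq (lower-first a b a<n b<n lt))
  ... | tri> _ _ gt | _           = ⊥-elim (<-irrefl (sym eq) (lower-first b a b<n a<n gt))
  ... | tri≈ _ _ _  | tri≈ _ a≡b _ = a≡b
  ... | tri≈ _ g≡ _ | tri< a<b _ _ = ⊥-elim (<-irrefl (sym eq) (rightmost-first a b a<n b<n g≡ a<b))
  ... | tri≈ _ g≡ _ | tri> _ _ b<a = ⊥-elim (<-irrefl eq (rightmost-first b a b<n a<n (sym g≡) b<a))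

  splitAt1-at : ∀ {p} → p < n → p < length ws → splitAt1 (at ws p) ws ≡ (take p ws , drop (suc p) ws)
  splitAt1-at {p} p<n p<len = splitAt1-first (at ws p) ws p<len refl λ q q<p at≡ →
    <-irrefl (injective (<-trans q<p p<n) p<n at≡) q<p

  take-avoids : ∀ {p i} → p ≤ i → i < n → All (_≢ at ws i) (take p ws)
  take-avoids {p} {i} p≤i i<n = All-at (take p ws) λ q q<len at≡ →
    let q<p = <-≤-trans q<len (subst (_≤ p) (sym (length-take p ws)) (m⊓n≤m p _))
        q<i = <-≤-trans q<p p≤i
    in <-irrefl (injective (<-trans q<i i<n) i<n (trans (sym (at-take ws q<p)) at≡)) q<i

SpitzerLabelling-window : ∀ {n r s gs ws gs′ ws′} → s + r ≤ n →
  (∀ a → a < r → at gs′ a ≡ at gs (s + a)) → (∀ a → a < r → at ws′ a ≡ at ws (s + a)) →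
  SpitzerLabelling n gs ws → SpitzerLabelling r gs′ ws′
SpitzerLabelling-window {n} {r} {s} {gs} {ws} {gs′} {ws′} s+r≤n gs′≡ ws′≡ L = record
  { lower-first = λ a b a<r b<r lt → subst₂ _<_ (sym (ws′≡ a a<r)) (sym (ws′≡ b b<r))
      (lower-first (s + a) (s + b) (inside a<r) (inside b<r)
        (subst₂ _<_ (gs′≡ a a<r) (gs′≡ b b<r) lt))
  ; rightmost-first = λ a b a<r b<r eq a<b → subst₂ _<_ (sym (ws′≡ b b<r)) (sym (ws′≡ a a<r))
      (rightmost-first (s + a) (s + b) (inside a<r) (inside b<r)
        (trans (sym (gs′≡ a a<r)) (trans eq (gs′≡ b b<r))) (+-monoʳ-< s a<b))
  }
  where
  open SpitzerLabelling L
  inside : ∀ {a} → a < r → s + a < n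
  inside a<r = <-≤-trans (+-monoʳ-< s a<r) s+r≤n

record Staircase (n c : ℕ) (gs : List ℕ) : Set where
  field
    starts : 0 < n → at gs 0 ≡ c
    above : ∀ j → j < n → c ≤ at gs j
    rises-by-one : ∀ j → suc j < n → at gs (suc j) ≤ suc (at gs j)

Staircase-take : ∀ {n c gs p} → p ≤ n → Staircase n c gs → Staircase p c (take p gs)
Staircase-take {gs = gs} p≤n S = record
  { starts = λ 0<p → trans (at-take gs 0<p) (starts (<-≤-trans 0<p p≤n))
  ; above = λ j j<p → subst (_ ≤_) (sym (at-take gs j<p)) (above j (<-≤-trans j<p p≤n))
  ; rises-by-one = λ j j+1<p →
      subst₂ (λ u v → u ≤ suc v) (sym (at-take gs j+1<p)) (sym (at-take gs (<-trans (n<1+n j) j+1<p)))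
        (rises-by-one j (<-≤-trans j+1<p p≤n))
  }
  where open Staircase S

Staircase-drop : ∀ {n c gs p} → p < n → at gs p ≡ c → (∀ j → p < j → j < n → c < at gs j) →
  Staircase n c gs → Staircase (n ∸ suc p) (suc c) (drop (suc p) gs)
Staircase-drop {n} {c} {gs} {p} p<n gp≡c higher S = record
  { starts = λ 0<r → let p+1<n = subst (_< n) (+-identityʳ (suc p)) (inside 0<r) in
      trans (at-drop gs (suc p) 0) (subst (λ u → at gs u ≡ suc c) (sym (+-identityʳ (suc p)))
        (≤-antisym (subst (λ v → at gs (suc p) ≤ suc v) gp≡c (rises-by-one p p+1<n))
                   (higher (suc p) ≤-refl p+1<n)))
  ; above = λ a a<r → subst (suc c ≤_) (sym (at-drop gs (suc p) a))
      (higher (suc p + a) (s≤s (m≤m+n p a)) (inside a<r))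
  ; rises-by-one = λ a a+1<r → subst₂ (λ u v → u ≤ suc v)
      (trans (cong (at gs) (sym (+-suc (suc p) a))) (sym (at-drop gs (suc p) (suc a))))
      (sym (at-drop gs (suc p) a))
      (rises-by-one (suc p + a) (subst (_< n) (+-suc (suc p) a) (inside a+1<r)))
  }
  where
  open Staircase S
  inside : ∀ {a} → a < n ∸ suc p → suc p + a < n
  inside a<r = subst (_ <_) (m+[n∸m]≡n p<n) (+-monoʳ-< (suc p) a<r)

module _ {n c gs ws} (L : SpitzerLabelling n gs ws) (S : Staircase n c gs)
         {p} (p<n : p < n) (minimal : ∀ j → j < n → at ws p ≤ at ws j) where
  open SpitzerLabelling L
  open Staircase S

  minimal-at-base : at gs p ≡ c
  minimal-at-base = ≤-antisym (≮⇒≥ c≮gp) (above p p<n)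
    where
    0<n : 0 < n
    0<n = <-≤-trans z<s p<n
    c≮gp : c < at gs p → _
    c≮gp c<gp = <⇒≱ (lower-first 0 p 0<n p<n (subst (_< at gs p) (sym (starts 0<n)) c<gp))
                    (minimal 0 0<n)

  after-minimal-above-base : ∀ j → p < j → j < n → c < at gs j
  after-minimal-above-base j p<j j<n = ≤∧≢⇒< (above j j<n) λ c≡gj →
    <⇒≱ (rightmost-first p j p<n j<n (trans minimal-at-base c≡gj) p<j) (minimal j j<n)

levelIn-fsF : ∀ f {n c gs} ws → n ≤ f → length ws ≡ n → SpitzerLabelling n gs ws →
  Staircase n c gs → ∀ j → j < n → levelIn (fsF f ws) (at ws j) ≡ just (at gs j ∸ c)
levelIn-fsF f       []       _  refl _ _ j ()
levelIn-fsF zero    (x ∷ xs) () refl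
levelIn-fsF (suc f) {n} {c} {gs} ws@(x ∷ xs) (s≤s xs≤f) refl L S j j<n =
  trans (cong (λ t → levelIn t (at ws j)) tree) (at-node (<-cmp j p))
  where
  open SpitzerLabelling L
  m = foldr _⊓_ x xs
  p = proj₁ (foldr-⊓-position x xs)
  p<n : p < n
  p<n = proj₁ (proj₂ (foldr-⊓-position x xs))
  at-p : at ws p ≡ m
  at-p = proj₂ (proj₂ (foldr-⊓-position x xs))
  minimal : ∀ i → i < n → at ws p ≤ at ws i
  minimal i i<n = subst (_≤ at ws i) (sym at-p) (foldr-⊓≤at x xs i<n)
  left right : List ℕ
  left = take p ws
  right = drop (suc p) ws
  tree : fsF (suc f) ws ≡ node (fsF f left) m (fsF f right)
  tree = cong (λ lr → node (fsF f (proj₁ lr)) m (fsF f (proj₂ lr)))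
    (subst (λ u → splitAt1 u ws ≡ (left , right)) at-p (splitAt1-at p<n p<n))
  m≢at : ∀ {i} → i < n → i ≢ p → (m ≡ᵇ at ws i) ≡ false
  m≢at i<n i≢p = ≢⇒≡ᵇ-false λ m≡ → i≢p (injective i<n p<n (trans (sym m≡) (sym at-p)))
  left-level : ∀ i → i < p → levelIn (fsF f left) (at ws i) ≡ just (at gs i ∸ c)
  left-level i i<p = subst₂ (λ u v → levelIn (fsF f left) u ≡ just (v ∸ c))
    (at-take ws i<p) (at-take gs i<p)
    (levelIn-fsF f left (≤-trans (≤-pred p<n) xs≤f) (trans (length-take p ws) (m≤n⇒m⊓n≡m (<⇒≤ p<n)))
      (SpitzerLabelling-window (<⇒≤ p<n) (λ _ a<p → at-take gs a<p) (λ _ a<p → at-take ws a<p) L)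
      (Staircase-take (<⇒≤ p<n) S) i i<p)
  right-level : ∀ i → p < i → i < n → levelIn (fsF f right) (at ws i) ≡ just (at gs i ∸ suc c)
  right-level i p<i i<n = subst (λ u → levelIn (fsF f right) (at ws u) ≡ just (at gs u ∸ suc c))
    (m+[n∸m]≡n p<i)
    (subst₂ (λ u v → levelIn (fsF f right) u ≡ just (v ∸ suc c))
      (at-drop ws (suc p) (i ∸ suc p)) (at-drop gs (suc p) (i ∸ suc p))
      (levelIn-fsF f right (≤-trans (m∸n≤m (length xs) p) xs≤f) (length-drop (suc p) ws)
        (SpitzerLabelling-window (≤-reflexive (m+[n∸m]≡n p<n))
          (λ a _ → at-drop gs (suc p) a) (λ a _ → at-drop ws (suc p) a) L)
        (Staircase-drop p<n (minimal-at-base L S p<n minimal)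
          (after-minimal-above-base L S p<n minimal) S)
        (i ∸ suc p) (∸-monoˡ-< i<n p<i)))
  at-node : Tri (j < p) (j ≡ p) (p < j) →
    levelIn (node (fsF f left) m (fsF f right)) (at ws j) ≡ just (at gs j ∸ c)
  at-node (tri< j<p _ _) = levelIn-left _ m _ (m≢at j<n (<⇒≢ j<p)) (left-level j j<p)
  at-node (tri≈ _ refl _) = trans (levelIn-root _ m _ (subst (λ u → (m ≡ᵇ u) ≡ true) (sym at-p) (≡ᵇ-refl m)))
    (cong just (sym (trans (cong (_∸ c) (minimal-at-base L S p<n minimal)) (n∸n≡0 c))))
  at-node (tri> _ _ p<j) = trans
    (levelIn-right _ m _ (m≢at j<n (≢-sym (<⇒≢ p<j)))
      (levelIn-fsF-absent f left (take-avoids (<⇒≤ p<j) j<n)))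
    (trans (cong (mapMaybe suc) (right-level j p<j j<n))
      (cong just (sym (m∸n≡1+[m∸1+n] (after-minimal-above-base L S p<n minimal j p<j j<n)))))

upLevels-head≤ : ∀ k h s → at (upLevels k h s) 0 ≤ h
upLevels-head≤ k h []      = z≤n
upLevels-head≤ k h (U ∷ s) = ≤-refl
upLevels-head≤ k h (D ∷ s) = ≤-trans (upLevels-head≤ k (h ∸ (k ∸ 1)) s) (m∸n≤m h (k ∸ 1))

upLevels-rise : ∀ k h s j → at (upLevels k h s) (suc j) ≤ suc (at (upLevels k h s) j)
upLevels-rise k h []      j       = z≤n
upLevels-rise k h (U ∷ s) zero    = upLevels-head≤ k (suc h) s
upLevels-rise k h (U ∷ s) (suc j) = upLevels-rise k (suc h) s j
upLevels-rise k h (D ∷ s) j       = upLevels-rise k (h ∸ (k ∸ 1)) s j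

Staircase-upLevels : ∀ k n s → Staircase n 0 (upLevels k 0 s)
Staircase-upLevels k n s = record
  { starts = λ _ → n≤0⇒n≡0 (upLevels-head≤ k 0 s)
  ; above = λ _ _ → z≤n
  ; rises-by-one = λ j _ → upLevels-rise k 0 s j
  }

corollary4p8 : (k n : ℕ) → 2 ≤ k → (P : List Step) → IsCatalanPath k n P →
    (σ : List ℕ) → σ ↭ map suc (upTo ((k ∸ 1) * n)) →
    (∀ i j → i < (k ∸ 1) * n → j < (k ∸ 1) * n →
      at (upLevels k 0 P) i < at (upLevels k 0 P) j → at σ i < at σ j) →
    (∀ i j → i < (k ∸ 1) * n → j < (k ∸ 1) * n →
      at (upLevels k 0 P) i ≡ at (upLevels k 0 P) j → i < j → at σ j < at σ i) →
    ∀ i → i < (k ∸ 1) * n →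
      levelIn (FS σ) (at σ i) ≡ just (at (upLevels k 0 P) i)
corollary4p8 k n _ P _ σ σ↭ lower-first rightmost-first =
  levelIn-fsF (length σ) σ (≤-reflexive (sym length-σ)) length-σ
    record { lower-first = lower-first ; rightmost-first = rightmost-first }
    (Staircase-upLevels k ((k ∸ 1) * n) P)
  where
  length-σ : length σ ≡ (k ∸ 1) * n
  length-σ = trans (↭-length σ↭) (trans (length-map suc (upTo ((k ∸ 1) * n))) (length-upTo ((k ∸ 1) * n)))
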